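{- If $\mathcal C\subseteq 2^{[n]}$ is inductively pierced, then $\mathcal C$ is degree two, that is, every element of $\mathrm{CF}(J_{\mathcal C})$ has degree two.
   Context: $[n]=\{1,\dots,n\}$. A code is a set $\mathcal C\subseteq 2^{[n]}$ satisfying the standing conventions: $\emptyset\in\mathcal C$; every neuron (element of $[n]$) lies in some codeword; no two distinct neurons lie in exactly the same codewords. $[\sigma,\tau]=\{\gamma:\sigma\subseteq\gamma\subseteq\tau\}$ has rank $|\tau\setminus\sigma|$. The deletion $\mathcal C\setminus i$ removes $i$ from every codeword. A neuron $i$ is a $k$-piercing of $\mathcal C$ if there are $\sigma\subseteq\tau\subseteq[n]\setminus\{i\}$ with $[\sigma,\tau]$ of rank $k$, $[\sigma,\tau]\subseteq\mathcal C\setminus i$, and $\mathcal C=(\mathcal C\setminus i)\cup[\sigma\cup\{i\},\tau\cup\{i\}]$. $\mathcal C$ is $k$-inductively pierced if $\mathcal C=\{\emptyset\}$ or some neuron $i$ is a $k'$-piercing with $k'\le k$ and $\mathcal C\setminus i$ is $k$-inductively pierced; inductively pierced means $k$-inductively pierced for some $k$. A pseudo-monomial is $\prod_{i\in\sigma}x_i\prod_{j\in\tau}(1-x_j)\in\mathbb F_2[x_1,\dots,x_n]$ with $\sigma\cap\tau=\emptyset$; these are ordered by divisibility. The neural ideal is $J_{\mathcal C}=\langle\prod_{i\in\sigma}x_i\prod_{j\notin\sigma}(1-x_j):\sigma\notin\mathcal C\rangle$, and $\mathrm{CF}(J_{\mathcal C})$ is the set of minimal pseudo-monomials in $J_{\mathcal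 C}$. -}

module Defs where

open import Level using (0ℓ)
open import Data.Nat using (ℕ; zero; suc; _+_; _≤_; _%_)
open import Data.Nat.Properties using () renaming (_≟_ to _≟ℕ_)
open import Data.Bool using (Bool; true; false; if_then_else_)
open import Data.Fin using (Fin)
open import Data.Fin.Subset using (Subset; ⊥; ⁅_⁆; _∈_; _∉_; _⊆_; _∪_; _─_; ∁; ∣_∣; inside; outside)
open import Data.Fin.Subset.Properties using (_∈?_)
open import Data.Vec using (Vec; replicate; tabulate; zipWith; lookup)
open import Data.Vec.Properties using (≡-dec)
open import Data.List using (List; []; _∷_; _++_; map; concatMap; foldr; allFin)
open import Data.List.Relation.Unary.All using (All)
open import Data.Product using (Σ; ∃; _×_; _,_; proj₁; proj₂)
open import Data.Sum using (_⊎_)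
open import Function.Bundles using (_⇔_)
open import Relation.Nullary using (¬_; yes; no)
open import Relation.Binary.PropositionalEquality using (_≡_)

Code : ℕ → Set₁
Code n = Subset n → Set

_≐_ : ∀ {n} → Code n → Code n → Set
C ≐ D = ∀ c → C c ⇔ D c

record Conventions {n : ℕ} (C : Code n) : Set where
  field
    empty∈   : C ⊥
    covered  : ∀ (i : Fin n) → Σ (Subset n) λ c → C c × i ∈ c
    separate : ∀ (i j : Fin n) → (∀ c → C c → (i ∈ c ⇔ j ∈ c)) → i ≡ j

del : ∀ {n} → Code n → Fin n → Code n
del {n} C i c = Σ (Subset n) λ d → C d × c ≡ d ─ ⁅ i ⁆

InInterval : ∀ {n} → Subset n → Subset n → Subset n → Set
InInterval σ τ γ = σ ⊆ γ × γ ⊆ τ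

Piercing : ∀ {n} → ℕ → Fin n → Code n → Set
Piercing {n} k i C =
  Σ (Subset n) λ σ → Σ (Subset n) λ τ →
    σ ⊆ τ × i ∉ τ × ∣ τ ─ σ ∣ ≡ k
    × (∀ γ → InInterval σ τ γ → del C i γ)
    × (∀ c → C c ⇔ (del C i c ⊎ InInterval (σ ∪ ⁅ i ⁆) (τ ∪ ⁅ i ⁆) c))

data KInductivelyPierced {n : ℕ} (k : ℕ) : Code n → Set₁ where
  base : ∀ {C} → C ≐ (λ c → c ≡ ⊥) → KInductivelyPierced k C
  step : ∀ {C} (i : Fin n) (k' : ℕ) → k' ≤ k → Piercing k' i C →
         KInductivelyPierced k (del C i) → KInductivelyPierced k C

InductivelyPierced : ∀ {n} → Code n → Set₁
InductivelyPierced C = Σ ℕ λ k → KInductivelyPierced k C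

-- Polynomials over 𝔽₂ in x₁..xₙ: a polynomial is a finite formal sum
-- (list) of monomials (exponent vectors); two lists denote the same
-- polynomial iff every monomial occurs with the same parity.

Mono : ℕ → Set
Mono n = Vec ℕ n

Poly : ℕ → Set
Poly n = List (Mono n)

occ : ∀ {n} → Mono n → Poly n → ℕ
occ m [] = 0
occ m (m' ∷ f) with ≡-dec _≟ℕ_ m m'
... | yes _ = suc (occ m f)
... | no _  = occ m f

_≈P_ : ∀ {n} → Poly n → Poly n → Set
f ≈P g = ∀ m → occ m f % 2 ≡ occ m g % 2

0P : ∀ {n} → Poly n
0P = []

1P : ∀ {n} → Poly n
1P {n} = replicate n 0 ∷ []

_+P_ : ∀ {n} → Poly n → Poly n → Poly n
f +P g = f ++ g

_*P_ : ∀ {n} → Poly n → Poly n → Poly n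
f *P g = concatMap (λ a → map (λ b → zipWith _+_ a b) g) f

var : ∀ {n} → Fin n → Poly n
var {n} i = tabulate exp ∷ []
  where
  exp : Fin n → ℕ
  exp j with j ∈? ⁅ i ⁆
  ... | yes _ = 1
  ... | no _  = 0

-- 1 - x_i  (= 1 + x_i over 𝔽₂)
onem : ∀ {n} → Fin n → Poly n
onem i = 1P +P var i

prodP : ∀ {n} → List (Poly n) → Poly n
prodP = foldr _*P_ 1P

Disjoint : ∀ {n} → Subset n → Subset n → Set
Disjoint σ τ = ∀ {x} → x ∈ σ → x ∉ τ

pm : ∀ {n} → Subset n → Subset n → Poly n
pm {n} σ τ = prodP (map factor (allFin n))
  where
  factor : Fin n → Poly n
  factor j with j ∈? σ | j ∈? τ
  ... | yes _ | _     = var j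
  ... | no _  | yes _ = onem j
  ... | no _  | no _  = 1P

pmDegree : ∀ {n} → Subset n → Subset n → ℕ
pmDegree σ τ = ∣ σ ∣ + ∣ τ ∣

_∣P_ : ∀ {n} → Poly n → Poly n → Set
g ∣P f = Σ (Poly _) λ h → f ≈P (h *P g)

ρ : ∀ {n} → Subset n → Poly n
ρ v = pm v (∁ v)

InJ : ∀ {n} → Code n → Poly n → Set
InJ {n} C f =
  Σ (List (Poly n × Subset n)) λ hs →
    All (λ p → ¬ C (proj₂ p)) hs
    × f ≈P foldr (λ p acc → (proj₁ p *P ρ (proj₂ p)) +P acc) 0P hs

InCF : ∀ {n} → Code n → Subset n → Subset n → Set
InCF {n} C σ τ =
  Disjoint σ τ × InJ C (pm σ τ)
  × (∀ (σ' τ' : Subset n) → Disjoint σ' τ' → InJ C (pm σ' τ') →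
       pm σ' τ' ∣P pm σ τ → pm σ τ ∣P pm σ' τ')

-- A pseudo-monomial x_σ ∏_{j∈τ}(1 - x_j) lies in J_C exactly when no codeword c has σ ⊆ c and
-- c ∩ τ = ∅: evaluating at the codewords gives one direction, and splitting
-- x_σ ∏(1 - x_τ) = x_{σ∪j} ∏(1 - x_τ) + x_σ ∏(1 - x_{τ∪j}) along the free coordinates j until
-- only generators ρ_v remain gives the other. Divisibility of pseudo-monomials forces inclusion
-- of their index sets (again by evaluation), so an element of CF(J_C) coincides with every
-- pseudo-monomial of J_C dividing it. For an inductively pierced code, induction along the
-- piercings shows that every pseudo-monomial of J_C is divisible by some x_i, x_i x_j or
-- x_i(1 - x_j) lying in J_C, and x_i is excluded because every neuron fires in some codeword.
module Submission where

open import Defs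
open import Algebra.Bundles using (CommutativeMonoid)
open import Data.Bool using (if_then_else_)
open import Data.Empty using (⊥-elim)
open import Data.Fin using (Fin; _≟_; punchIn)
import Data.Fin as Fin
open import Data.Fin.Properties using (punchInᵢ≢i; any?)
open import Data.Fin.Subset using (Subset; _∈_; _∉_; _⊆_; ⁅_⁆; _∪_; _─_; ∁; ∣_∣; inside; outside)
  renaming (⊥ to ∅)
open import Data.Fin.Subset.Properties
  using (_∈?_; nonempty?; drop-there; ⊆-refl; ⊆-antisym; ⊥⊆; ∉⊥; x∈⁅x⁆; x∈⁅y⁆⇒x≡y; x∈p∪q⁺; x∈p∪q⁻;
         p⊆p∪q; q⊆p∪q; p─q⊆p; x∈p∧x∉q⇒x∈p─q; x∈p⇒x∉∁p; x∈∁p⇒x∉p; x∉p⇒x∈∁p; x∉∁p⇒x∈p;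
         ∪-identityˡ; ∪-identityʳ; ∣⊥∣≡0; ∣⁅x⁆∣≡1)
open import Data.List using (List; []; _∷_; _++_; map; foldr; length; allFin; tabulate)
open import Data.List.Membership.Propositional using () renaming (_∈_ to _∈ᴸ_)
open import Data.List.Membership.Propositional.Properties using (∈-allFin)
open import Data.List.Properties using (map-cong; map-tabulate; ++-assoc; ++-identityʳ)
open import Data.List.Relation.Unary.All using (All; []; _∷_)
open import Data.List.Relation.Unary.All.Properties using (++⁺)
open import Data.List.Relation.Unary.Any using (here; there)
open import Data.Nat using (ℕ; zero; suc; _+_; _≤_; _<_; _%_; s≤s; z≤n; parity)
open import Data.Nat.Induction using (<-wellFounded)
open import Data.Nat.Properties using (1+n≢0; m≤n⇒m≤1+n; +-identityʳ)
import Data.Nat.Properties as ℕ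
open import Data.Parity.Base as ℙ using (Parity; 0ℙ; 1ℙ)
import Data.Parity.Properties as ℙ
open import Data.Product using (Σ; _×_; _,_; proj₁; proj₂)
open import Data.Sum using (_⊎_; inj₁; inj₂)
import Data.Sum as Sum
open import Data.Vec using ([]; _∷_; here; there; zipWith; replicate; lookup)
import Data.Vec as Vec
open import Data.Vec.Functional using (removeAt)
import Data.Vec.Functional as Vector
open import Data.Vec.Properties using (≡-dec; lookup∘tabulate; zipWith-comm; zipWith-assoc; zipWith-identityˡ)
open import Function.Base using (id; _∘_; _on_)
open import Function.Bundles using (_⇔_; mk⇔; Equivalence)
open import Function.Properties.Equivalence using () renaming (refl to ⇔-refl)
open import Induction.WellFounded using (Acc; acc)
open import Relation.Binary.Bundles using (Setoid)
open import Relation.Binary.Construct.On using () renaming (wellFounded to on-wellFounded)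
import Relation.Binary.Reasoning.Setoid
open import Relation.Binary.PropositionalEquality
  using (_≡_; _≢_; refl; sym; trans; cong; cong₂; subst; subst₂; module ≡-Reasoning)
open import Relation.Nullary using (¬_; Dec; yes; no; does; ¬?)
open import Relation.Nullary.Decidable using (dec-true; dec-false; _×-dec_)

open import Algebra.Properties.CommutativeSemigroup ℙ.+-commutativeSemigroup
  using (interchange; x∙yz≈y∙xz)

bit : Parity → ℕ
bit 0ℙ = 0
bit 1ℙ = 1

bit-injective : ∀ {p q} → bit p ≡ bit q → p ≡ q
bit-injective {0ℙ} {0ℙ} _ = refl
bit-injective {1ℙ} {1ℙ} _ = refl

m%2≡bit∘parity : ∀ m → m % 2 ≡ bit (parity m)
m%2≡bit∘parity 0             = refl
m%2≡bit∘parity 1             = refl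
m%2≡bit∘parity (suc (suc m)) = m%2≡bit∘parity m

%2≡⇒parity≡ : ∀ m n → m % 2 ≡ n % 2 → parity m ≡ parity n
%2≡⇒parity≡ m n eq = bit-injective (trans (sym (m%2≡bit∘parity m)) (trans eq (m%2≡bit∘parity n)))

parity≡⇒%2≡ : ∀ m n → parity m ≡ parity n → m % 2 ≡ n % 2
parity≡⇒%2≡ m n eq = trans (m%2≡bit∘parity m) (trans (cong bit eq) (sym (m%2≡bit∘parity n)))

0ℙ≢1ℙ : 0ℙ ≢ 1ℙ
0ℙ≢1ℙ ()

*≡1ℙ⁻ : ∀ p q → p ℙ.* q ≡ 1ℙ → p ≡ 1ℙ × q ≡ 1ℙ
*≡1ℙ⁻ 1ℙ 1ℙ _ = refl , refl

module _ {c ℓ} (M : CommutativeMonoid c ℓ) where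
  open CommutativeMonoid M using (_≈_; _∙_; ε; ∙-congˡ; identityʳ; setoid)
  open import Algebra.Properties.CommutativeMonoid.Sum M using (sum; sum-remove; sum-cong-≗; sum-replicate-zero)
  open Relation.Binary.Reasoning.Setoid setoid

  sum-single : ∀ {m} (i : Fin m) x → sum (λ j → if does (j ≟ i) then x else ε) ≈ x
  sum-single {suc m} i x = begin
    sum t                          ≈⟨ sum-remove {i = i} t ⟩
    t i ∙ sum (removeAt t i)       ≡⟨ cong₂ _∙_ (cong (if_then x else ε) (dec-true (i ≟ i) refl)) (sum-cong-≗ {m} away) ⟩
    x ∙ sum (Vector.replicate m ε) ≈⟨ ∙-congˡ (sum-replicate-zero m) ⟩
    x ∙ ε                          ≈⟨ identityʳ x ⟩
    x                              ∎
    where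
    t = λ j → if does (j ≟ i) then x else ε
    away : ∀ j → removeAt t i j ≡ ε
    away j = cong (if_then x else ε) (dec-false (punchIn i j ≟ i) (punchInᵢ≢i i j))

x∈p─q⇒x∉q : ∀ {n} {p q : Subset n} {x} → x ∈ p ─ q → x ∉ q
x∈p─q⇒x∉q {p = _ ∷ _} {outside ∷ _} here        ()
x∈p─q⇒x∉q {p = _ ∷ _} {_ ∷ _}       (there x∈) (there x∈q) = x∈p─q⇒x∉q x∈ x∈q

∣⁅x⁆∪⁅y⁆∣≡2 : ∀ {n} {x y : Fin n} → x ≢ y → ∣ ⁅ x ⁆ ∪ ⁅ y ⁆ ∣ ≡ 2
∣⁅x⁆∪⁅y⁆∣≡2 {x = Fin.zero}  {Fin.zero}  x≢y = ⊥-elim (x≢y refl)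
∣⁅x⁆∪⁅y⁆∣≡2 {x = Fin.zero}  {Fin.suc y} _   = cong suc (trans (cong ∣_∣ (∪-identityˡ ⁅ y ⁆)) (∣⁅x⁆∣≡1 y))
∣⁅x⁆∪⁅y⁆∣≡2 {x = Fin.suc x} {Fin.zero}  _   = cong suc (trans (cong ∣_∣ (∪-identityʳ ⁅ x ⁆)) (∣⁅x⁆∣≡1 x))
∣⁅x⁆∪⁅y⁆∣≡2 {x = Fin.suc x} {Fin.suc y} x≢y = ∣⁅x⁆∪⁅y⁆∣≡2 (x≢y ∘ cong Fin.suc)

module _ {n : ℕ} where

  ⁅x⁆⊆p : ∀ {x} {p : Subset n} → x ∈ p → ⁅ x ⁆ ⊆ p
  ⁅x⁆⊆p {x} {p} x∈p y∈x = subst (_∈ p) (sym (x∈⁅y⁆⇒x≡y x y∈x)) x∈p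

  ∪-⊆ : ∀ {p q r : Subset n} → p ⊆ r → q ⊆ r → p ∪ q ⊆ r
  ∪-⊆ {p} {q} p⊆r q⊆r x∈p∪q with x∈p∪q⁻ p q x∈p∪q
  ... | inj₁ x∈p = p⊆r x∈p
  ... | inj₂ x∈q = q⊆r x∈q

  x∈p∪⁅x⁆ : ∀ (p : Subset n) x → x ∈ p ∪ ⁅ x ⁆
  x∈p∪⁅x⁆ p x = x∈p∪q⁺ (inj₂ (x∈⁅x⁆ x))

  ∈-∪⁅⁆⇔ : ∀ {p : Subset n} {x y} → x ≢ y → (x ∈ p ∪ ⁅ y ⁆ ⇔ x ∈ p)
  ∈-∪⁅⁆⇔ {p} {x} {y} x≢y = mk⇔ to (λ x∈p → x∈p∪q⁺ (inj₁ x∈p))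
    where
    to : x ∈ p ∪ ⁅ y ⁆ → x ∈ p
    to x∈ with x∈p∪q⁻ p ⁅ y ⁆ x∈
    ... | inj₁ x∈p = x∈p
    ... | inj₂ x∈y = ⊥-elim (x≢y (x∈⁅y⁆⇒x≡y y x∈y))

  ∈-─⇔ : ∀ {p q : Subset n} {x} → x ∉ q → (x ∈ p ─ q ⇔ x ∈ p)
  ∈-─⇔ {p} {q} x∉q = mk⇔ (p─q⊆p p q) (λ x∈p → x∈p∧x∉q⇒x∈p─q x∈p x∉q)

-- Polynomials over 𝔽₂

infixl 7 _·_

_·_ : ∀ {n} → Mono n → Mono n → Mono n
a · b = zipWith _+_ a b

module _ {n : ℕ} where

  sumBy : (Mono n → Parity) → Poly n → Parity
  sumBy w []      = 0ℙ
  sumBy w (m ∷ f) = w m ℙ.+ sumBy w f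

  -- Formal sums are compared through every 𝔽₂-valued functional on monomials. This agrees with
  -- the parity count _≈P_ (≈⇒≈P, ≈P⇒≈) and is visibly a congruence for _+P_ and _*P_.
  infix 4 _≈_

  record _≈_ (f g : Poly n) : Set where
    constructor mk≈
    field sumBy-≡ : ∀ w → sumBy w f ≡ sumBy w g

  open _≈_ public

  sumBy-cong : ∀ {u v} → (∀ m → u m ≡ v m) → ∀ f → sumBy u f ≡ sumBy v f
  sumBy-cong u≗v []      = refl
  sumBy-cong u≗v (m ∷ f) = cong₂ ℙ._+_ (u≗v m) (sumBy-cong u≗v f)

  sumBy-++ : ∀ w f g → sumBy w (f ++ g) ≡ sumBy w f ℙ.+ sumBy w g
  sumBy-++ w []      g = refl
  sumBy-++ w (m ∷ f) g = trans (cong (w m ℙ.+_) (sumBy-++ w f g)) (sym (ℙ.+-assoc (w m) _ _))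

  sumBy-map : ∀ w (h : Mono n → Mono n) f → sumBy w (map h f) ≡ sumBy (λ m → w (h m)) f
  sumBy-map w h []      = refl
  sumBy-map w h (m ∷ f) = cong (w (h m) ℙ.+_) (sumBy-map w h f)

  sumBy-+ : ∀ u v f → sumBy (λ m → u m ℙ.+ v m) f ≡ sumBy u f ℙ.+ sumBy v f
  sumBy-+ u v []      = refl
  sumBy-+ u v (m ∷ f) = trans (cong (u m ℙ.+ v m ℙ.+_) (sumBy-+ u v f)) (interchange (u m) (v m) _ _)

  sumBy-zero : ∀ f → sumBy (λ _ → 0ℙ) f ≡ 0ℙ
  sumBy-zero []      = refl
  sumBy-zero (_ ∷ f) = sumBy-zero f

  sumBy-*ˡ : ∀ c u f → sumBy (λ m → c ℙ.* u m) f ≡ c ℙ.* sumBy u f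
  sumBy-*ˡ c u []      = sym (ℙ.*-zeroʳ c)
  sumBy-*ˡ c u (m ∷ f) = trans (cong (c ℙ.* u m ℙ.+_) (sumBy-*ˡ c u f)) (sym (ℙ.*-distribˡ-+ c (u m) _))

  sumBy-*ʳ : ∀ c (u : Mono n → Parity) f → sumBy (λ m → u m ℙ.* c) f ≡ sumBy u f ℙ.* c
  sumBy-*ʳ c u []      = refl
  sumBy-*ʳ c u (m ∷ f) = trans (cong (u m ℙ.* c ℙ.+_) (sumBy-*ʳ c u f)) (sym (ℙ.*-distribʳ-+ c (u m) _))

  sumBy-swap : ∀ (w : Mono n → Mono n → Parity) f g →
               sumBy (λ a → sumBy (w a) g) f ≡ sumBy (λ b → sumBy (λ a → w a b) f) g
  sumBy-swap w []      g = sym (sumBy-zero g)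
  sumBy-swap w (a ∷ f) g =
    trans (cong (sumBy (w a) g ℙ.+_) (sumBy-swap w f g)) (sym (sumBy-+ (w a) _ g))

  sumBy-*P : ∀ w f g → sumBy w (f *P g) ≡ sumBy (λ a → sumBy (λ b → w (a · b)) g) f
  sumBy-*P w []      g = refl
  sumBy-*P w (a ∷ f) g = begin
    sumBy w (map (a ·_) g ++ f *P g)
      ≡⟨ sumBy-++ w (map (a ·_) g) (f *P g) ⟩
    sumBy w (map (a ·_) g) ℙ.+ sumBy w (f *P g)
      ≡⟨ cong₂ ℙ._+_ (sumBy-map w (a ·_) g) (sumBy-*P w f g) ⟩
    sumBy (λ b → w (a · b)) g ℙ.+ sumBy (λ a → sumBy (λ b → w (a · b)) g) f ∎
    where open ≡-Reasoning

  ≈-setoid : Setoid _ _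
  ≈-setoid = record
    { Carrier       = Poly n
    ; _≈_           = _≈_
    ; isEquivalence = record
      { refl  = mk≈ λ _ → refl
      ; sym   = λ f≈g → mk≈ λ w → sym (sumBy-≡ f≈g w)
      ; trans = λ f≈g g≈h → mk≈ λ w → trans (sumBy-≡ f≈g w) (sumBy-≡ g≈h w)
      }
    }

  open Setoid ≈-setoid public using () renaming (refl to ≈-refl; trans to ≈-trans; reflexive to ≡⇒≈)

  +P-cong : ∀ {f f′ g g′} → f ≈ f′ → g ≈ g′ → f +P g ≈ f′ +P g′
  +P-cong {f} {f′} {g} {g′} f≈f′ g≈g′ = mk≈ λ w → begin
    sumBy w (f ++ g)          ≡⟨ sumBy-++ w f g ⟩
    sumBy w f ℙ.+ sumBy w g   ≡⟨ cong₂ ℙ._+_ (sumBy-≡ f≈f′ w) (sumBy-≡ g≈g′ w) ⟩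
    sumBy w f′ ℙ.+ sumBy w g′ ≡⟨ sumBy-++ w f′ g′ ⟨
    sumBy w (f′ ++ g′)        ∎
    where open ≡-Reasoning

  +P-cancelˡ : ∀ f g → f +P (g +P f) ≈ g
  +P-cancelˡ f g = mk≈ λ w → begin
    sumBy w (f ++ (g ++ f))                 ≡⟨ trans (sumBy-++ w f (g ++ f)) (cong (sumBy w f ℙ.+_) (sumBy-++ w g f)) ⟩
    sumBy w f ℙ.+ (sumBy w g ℙ.+ sumBy w f) ≡⟨ x∙yz≈y∙xz (sumBy w f) (sumBy w g) (sumBy w f) ⟩
    sumBy w g ℙ.+ (sumBy w f ℙ.+ sumBy w f) ≡⟨ cong (sumBy w g ℙ.+_) (ℙ.p+p≡0ℙ (sumBy w f)) ⟩
    sumBy w g ℙ.+ 0ℙ                        ≡⟨ ℙ.+-identityʳ (sumBy w g) ⟩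
    sumBy w g                               ∎
    where open ≡-Reasoning

  *P-cong : ∀ {f f′ g g′} → f ≈ f′ → g ≈ g′ → f *P g ≈ f′ *P g′
  *P-cong {f} {f′} {g} {g′} f≈f′ g≈g′ = mk≈ λ w → begin
    sumBy w (f *P g)                            ≡⟨ sumBy-*P w f g ⟩
    sumBy (λ a → sumBy (λ b → w (a · b)) g) f   ≡⟨ sumBy-cong (λ a → sumBy-≡ g≈g′ _) f ⟩
    sumBy (λ a → sumBy (λ b → w (a · b)) g′) f  ≡⟨ sumBy-≡ f≈f′ _ ⟩
    sumBy (λ a → sumBy (λ b → w (a · b)) g′) f′ ≡⟨ sumBy-*P w f′ g′ ⟨
    sumBy w (f′ *P g′)                          ∎
    where open ≡-Reasoning

  *P-congˡ : ∀ f {g g′} → g ≈ g′ → f *P g ≈ f *P g′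
  *P-congˡ f = *P-cong (≈-refl {f})

  *P-comm : ∀ f g → f *P g ≈ g *P f
  *P-comm f g = mk≈ λ w → begin
    sumBy w (f *P g)                          ≡⟨ sumBy-*P w f g ⟩
    sumBy (λ a → sumBy (λ b → w (a · b)) g) f ≡⟨ sumBy-swap _ f g ⟩
    sumBy (λ b → sumBy (λ a → w (a · b)) f) g ≡⟨ sumBy-cong (λ b → sumBy-cong (λ a → cong w (zipWith-comm ℕ.+-comm a b)) f) g ⟩
    sumBy (λ b → sumBy (λ a → w (b · a)) f) g ≡⟨ sumBy-*P w g f ⟨
    sumBy w (g *P f)                          ∎
    where open ≡-Reasoning

  *P-assoc : ∀ f g h → (f *P g) *P h ≈ f *P (g *P h)
  *P-assoc f g h = mk≈ λ w → begin
    sumBy w ((f *P g) *P h)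
      ≡⟨ sumBy-*P w (f *P g) h ⟩
    sumBy (λ ab → sumBy (λ c → w (ab · c)) h) (f *P g)
      ≡⟨ sumBy-*P _ f g ⟩
    sumBy (λ a → sumBy (λ b → sumBy (λ c → w (a · b · c)) h) g) f
      ≡⟨ sumBy-cong (λ a → sumBy-cong (λ b → sumBy-cong (λ c → cong w (zipWith-assoc ℕ.+-assoc a b c)) h) g) f ⟩
    sumBy (λ a → sumBy (λ b → sumBy (λ c → w (a · (b · c))) h) g) f
      ≡⟨ sumBy-cong (λ a → sumBy-*P (λ bc → w (a · bc)) g h) f ⟨
    sumBy (λ a → sumBy (λ bc → w (a · bc)) (g *P h)) f
      ≡⟨ sumBy-*P w f (g *P h) ⟨
    sumBy w (f *P (g *P h))
      ∎
    where open ≡-Reasoning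

  *P-identityˡ : ∀ f → 1P *P f ≈ f
  *P-identityˡ f = mk≈ λ w → begin
    sumBy w (1P *P f)                            ≡⟨ sumBy-*P w 1P f ⟩
    sumBy (λ b → w (replicate n 0 · b)) f ℙ.+ 0ℙ ≡⟨ ℙ.+-identityʳ _ ⟩
    sumBy (λ b → w (replicate n 0 · b)) f        ≡⟨ sumBy-cong (λ b → cong w (zipWith-identityˡ (λ _ → refl) b)) f ⟩
    sumBy w f                                    ∎
    where open ≡-Reasoning

  *P-identityʳ : ∀ f → f *P 1P ≈ f
  *P-identityʳ f = ≈-trans (*P-comm f 1P) (*P-identityˡ f)

  *P-distribˡ-+P : ∀ f g h → f *P (g +P h) ≈ (f *P g) +P (f *P h)
  *P-distribˡ-+P f g h = mk≈ λ w → begin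
    sumBy w (f *P (g ++ h))
      ≡⟨ sumBy-*P w f (g ++ h) ⟩
    sumBy (λ a → sumBy (λ b → w (a · b)) (g ++ h)) f
      ≡⟨ sumBy-cong (λ a → sumBy-++ _ g h) f ⟩
    sumBy (λ a → sumBy (λ b → w (a · b)) g ℙ.+ sumBy (λ b → w (a · b)) h) f
      ≡⟨ sumBy-+ _ _ f ⟩
    sumBy (λ a → sumBy (λ b → w (a · b)) g) f ℙ.+ sumBy (λ a → sumBy (λ b → w (a · b)) h) f
      ≡⟨ cong₂ ℙ._+_ (sumBy-*P w f g) (sumBy-*P w f h) ⟨
    sumBy w (f *P g) ℙ.+ sumBy w (f *P h)
      ≡⟨ sumBy-++ w (f *P g) (f *P h) ⟨
    sumBy w ((f *P g) ++ (f *P h))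
      ∎
    where open ≡-Reasoning

*P-commutativeMonoid : ℕ → CommutativeMonoid _ _
*P-commutativeMonoid n = record
  { Carrier             = Poly n
  ; _≈_                 = _≈_
  ; _∙_                 = _*P_
  ; ε                   = 1P
  ; isCommutativeMonoid = record
    { isMonoid = record
      { isSemigroup = record
        { isMagma = record { isEquivalence = Setoid.isEquivalence ≈-setoid ; ∙-cong = *P-cong }
        ; assoc   = *P-assoc
        }
      ; identity = *P-identityˡ , *P-identityʳ
      }
    ; comm = *P-comm
    }
  }

module ≈-Reasoning {n : ℕ} = Relation.Binary.Reasoning.Setoid (≈-setoid {n})

module _ {n : ℕ} where

  δ : Mono n → Mono n → Parity
  δ m m′ with ≡-dec ℕ._≟_ m m′
  ... | yes _ = 1ℙ
  ... | no  _ = 0ℙ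

  parity-occ : ∀ m f → parity (occ m f) ≡ sumBy (δ m) f
  parity-occ m []       = refl
  parity-occ m (m′ ∷ f) with ≡-dec ℕ._≟_ m m′
  ... | yes _ = trans (ℙ.+-homo-+ 1 (occ m f)) (cong (1ℙ ℙ.+_) (parity-occ m f))
  ... | no  _ = parity-occ m f

  ≈⇒≈P : ∀ {f g : Poly n} → f ≈ g → f ≈P g
  ≈⇒≈P {f} {g} f≈g m =
    parity≡⇒%2≡ (occ m f) (occ m g) (trans (parity-occ m f) (trans (sumBy-≡ f≈g (δ m)) (sym (parity-occ m g))))

  remove : Mono n → Poly n → Poly n
  remove m []       = []
  remove m (m′ ∷ f) with ≡-dec ℕ._≟_ m m′
  ... | yes _ = remove m f
  ... | no  _ = m′ ∷ remove m f

  sumBy-remove : ∀ w m f → sumBy w f ≡ parity (occ m f) ℙ.* w m ℙ.+ sumBy w (remove m f)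
  sumBy-remove w m []       = sym (ℙ.+-identityʳ _)
  sumBy-remove w m (m′ ∷ f) with ≡-dec ℕ._≟_ m m′
  ... | yes refl = begin
    w m ℙ.+ sumBy w f                    ≡⟨ cong (w m ℙ.+_) (sumBy-remove w m f) ⟩
    w m ℙ.+ (p ℙ.* w m ℙ.+ r)            ≡⟨ ℙ.+-assoc (w m) _ r ⟨
    w m ℙ.+ (p ℙ.* w m) ℙ.+ r            ≡⟨ cong (ℙ._+ r) (ℙ.*-distribʳ-+ (w m) 1ℙ p) ⟨
    (1ℙ ℙ.+ p) ℙ.* w m ℙ.+ r             ≡⟨ cong (λ q → q ℙ.* w m ℙ.+ r) (ℙ.+-homo-+ 1 (occ m f)) ⟨
    parity (suc (occ m f)) ℙ.* w m ℙ.+ r ∎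
    where
    open ≡-Reasoning
    p = parity (occ m f)
    r = sumBy w (remove m f)
  ... | no  _ = trans (cong (w m′ ℙ.+_) (sumBy-remove w m f)) (x∙yz≈y∙xz (w m′) (parity (occ m f) ℙ.* w m) (sumBy w (remove m f)))

  remove-∷ : ∀ m f → remove m (m ∷ f) ≡ remove m f
  remove-∷ m f with ≡-dec ℕ._≟_ m m
  ... | yes _  = refl
  ... | no m≢m = ⊥-elim (m≢m refl)

  length-remove : ∀ m f → length (remove m f) ≤ length f
  length-remove m []       = z≤n
  length-remove m (m′ ∷ f) with ≡-dec ℕ._≟_ m m′
  ... | yes _ = m≤n⇒m≤1+n (length-remove m f)
  ... | no  _ = s≤s (length-remove m f)

  occ-remove-≡ : ∀ m f → occ m (remove m f) ≡ 0
  occ-remove-≡ m []       = refl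
  occ-remove-≡ m (m′ ∷ f) with ≡-dec ℕ._≟_ m m′
  ... | yes _   = occ-remove-≡ m f
  ... | no m≢m′ with ≡-dec ℕ._≟_ m m′
  ...   | yes m≡m′ = ⊥-elim (m≢m′ m≡m′)
  ...   | no  _    = occ-remove-≡ m f

  occ-remove-≢ : ∀ {m m′} f → m′ ≢ m → occ m′ (remove m f) ≡ occ m′ f
  occ-remove-≢ []        _     = refl
  occ-remove-≢ {m} {m′} (m″ ∷ f) m′≢m with ≡-dec ℕ._≟_ m m″
  ... | yes refl with ≡-dec ℕ._≟_ m′ m
  ...   | yes m′≡m = ⊥-elim (m′≢m m′≡m)
  ...   | no  _    = occ-remove-≢ f m′≢m
  occ-remove-≢ {m} {m′} (m″ ∷ f) m′≢m | no _ with ≡-dec ℕ._≟_ m′ m″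
  ...   | yes _ = cong suc (occ-remove-≢ f m′≢m)
  ...   | no  _ = occ-remove-≢ f m′≢m

  OccursEvenly : Poly n → Set
  OccursEvenly f = ∀ m → parity (occ m f) ≡ 0ℙ

  OccursEvenly-remove : ∀ {f} m → OccursEvenly f → OccursEvenly (remove m f)
  OccursEvenly-remove {f} m even m′ with ≡-dec ℕ._≟_ m′ m
  ... | yes refl = cong parity (occ-remove-≡ m f)
  ... | no m′≢m  = trans (cong parity (occ-remove-≢ f m′≢m)) (even m′)

  sumBy-OccursEvenly : ∀ w f → OccursEvenly f → sumBy w f ≡ 0ℙ
  sumBy-OccursEvenly w f = go f (on-wellFounded length <-wellFounded f)
    where
    go : ∀ f → Acc (_<_ on length) f → OccursEvenly f → sumBy w f ≡ 0ℙ
    go []      _        _    = refl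
    go (m ∷ f) (acc rs) even = begin
      sumBy w (m ∷ f)                                 ≡⟨ sumBy-remove w m (m ∷ f) ⟩
      parity (occ m (m ∷ f)) ℙ.* w m ℙ.+ sumBy w rest ≡⟨ cong₂ (λ p r → p ℙ.* w m ℙ.+ r) (even m) rest≡0 ⟩
      0ℙ                                              ∎
      where
      open ≡-Reasoning
      rest = remove m (m ∷ f)
      shorter : length rest < length (m ∷ f)
      shorter = s≤s (subst (λ g → length g ≤ length f) (sym (remove-∷ m f)) (length-remove m f))
      rest≡0 : sumBy w rest ≡ 0ℙ
      rest≡0 = go rest (rs shorter) (OccursEvenly-remove {m ∷ f} m even)

  occ-++ : ∀ (m : Mono n) f g → occ m (f ++ g) ≡ occ m f + occ m g
  occ-++ m []       g = refl
  occ-++ m (m′ ∷ f) g with ≡-dec ℕ._≟_ m m′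
  ... | yes _ = cong suc (occ-++ m f g)
  ... | no  _ = occ-++ m f g

  ≈P⇒OccursEvenly-++ : ∀ {f g : Poly n} → f ≈P g → OccursEvenly (f ++ g)
  ≈P⇒OccursEvenly-++ {f} {g} f≈g m = begin
    parity (occ m (f ++ g))               ≡⟨ cong parity (occ-++ m f g) ⟩
    parity (occ m f + occ m g)            ≡⟨ ℙ.+-homo-+ (occ m f) (occ m g) ⟩
    parity (occ m f) ℙ.+ parity (occ m g) ≡⟨ cong (ℙ._+ parity (occ m g)) (%2≡⇒parity≡ (occ m f) (occ m g) (f≈g m)) ⟩
    parity (occ m g) ℙ.+ parity (occ m g) ≡⟨ ℙ.p+p≡0ℙ (parity (occ m g)) ⟩
    0ℙ                                    ∎
    where open ≡-Reasoning

  ≈P⇒≈ : ∀ {f g : Poly n} → f ≈P g → f ≈ g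
  ≈P⇒≈ {f} {g} f≈g = mk≈ λ w → ℙ.+-cancelʳ-≡ (sumBy w g) (sumBy w f) (sumBy w g) (begin
    sumBy w f ℙ.+ sumBy w g ≡⟨ sumBy-++ w f g ⟨
    sumBy w (f ++ g)        ≡⟨ sumBy-OccursEvenly w (f ++ g) (≈P⇒OccursEvenly-++ {f} {g} f≈g) ⟩
    0ℙ                      ≡⟨ ℙ.p+p≡0ℙ (sumBy w g) ⟨
    sumBy w g ℙ.+ sumBy w g ∎)
    where open ≡-Reasoning

-- Evaluation at the points of {0,1}ⁿ, a subset being read as its indicator vector

evalMono : ∀ {n} → Subset n → Mono n → Parity
evalMono []            []          = 1ℙ
evalMono (inside  ∷ x) (_ ∷ m)     = evalMono x m
evalMono (outside ∷ x) (zero ∷ m)  = evalMono x m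
evalMono (outside ∷ x) (suc _ ∷ m) = 0ℙ

evalMono-+ : ∀ {n} (x : Subset n) a b → evalMono x (a · b) ≡ evalMono x a ℙ.* evalMono x b
evalMono-+ []            []          []          = refl
evalMono-+ (inside  ∷ x) (_ ∷ a)     (_ ∷ b)     = evalMono-+ x a b
evalMono-+ (outside ∷ x) (zero ∷ a)  (zero ∷ b)  = evalMono-+ x a b
evalMono-+ (outside ∷ x) (zero ∷ a)  (suc _ ∷ b) = sym (ℙ.*-zeroʳ (evalMono x a))
evalMono-+ (outside ∷ x) (suc _ ∷ a) (_ ∷ b)     = refl

evalMono-0 : ∀ {n} (x : Subset n) → evalMono x (replicate n 0) ≡ 1ℙ
evalMono-0 []            = refl
evalMono-0 (inside  ∷ x) = evalMono-0 x
evalMono-0 (outside ∷ x) = evalMono-0 x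

evalMono≡1ℙ : ∀ {n} (x : Subset n) m → (∀ k → lookup m k ≡ 0 ⊎ k ∈ x) → evalMono x m ≡ 1ℙ
evalMono≡1ℙ []            []      _ = refl
evalMono≡1ℙ (inside  ∷ x) (_ ∷ m) h = evalMono≡1ℙ x m (λ k → Sum.map₂ drop-there (h (Fin.suc k)))
evalMono≡1ℙ (outside ∷ x) (e ∷ m) h with h Fin.zero
... | inj₁ refl = evalMono≡1ℙ x m (λ k → Sum.map₂ drop-there (h (Fin.suc k)))
... | inj₂ ()

evalMono≡0ℙ : ∀ {n} (x : Subset n) m k → lookup m k ≢ 0 → k ∉ x → evalMono x m ≡ 0ℙ
evalMono≡0ℙ (inside  ∷ x) (_ ∷ m)     Fin.zero    _   k∉x = ⊥-elim (k∉x here)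
evalMono≡0ℙ (outside ∷ x) (zero ∷ m)  Fin.zero    e≢0 _   = ⊥-elim (e≢0 refl)
evalMono≡0ℙ (outside ∷ x) (suc _ ∷ m) Fin.zero    _   _   = refl
evalMono≡0ℙ (inside  ∷ x) (_ ∷ m)     (Fin.suc k) e≢0 k∉x = evalMono≡0ℙ x m k e≢0 (k∉x ∘ there)
evalMono≡0ℙ (outside ∷ x) (zero ∷ m)  (Fin.suc k) e≢0 k∉x = evalMono≡0ℙ x m k e≢0 (k∉x ∘ there)
evalMono≡0ℙ (outside ∷ x) (suc _ ∷ m) (Fin.suc k) _   _   = refl

module _ {n : ℕ} where

  eval : Subset n → Poly n → Parity
  eval x = sumBy (evalMono x)

  eval-≈ : ∀ x {f g} → f ≈ g → eval x f ≡ eval x g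
  eval-≈ x f≈g = sumBy-≡ f≈g (evalMono x)

  eval-+P : ∀ x f g → eval x (f +P g) ≡ eval x f ℙ.+ eval x g
  eval-+P x = sumBy-++ (evalMono x)

  eval-*P : ∀ x f g → eval x (f *P g) ≡ eval x f ℙ.* eval x g
  eval-*P x f g = begin
    eval x (f *P g)                                               ≡⟨ sumBy-*P (evalMono x) f g ⟩
    sumBy (λ a → sumBy (λ b → evalMono x (a · b)) g) f            ≡⟨ sumBy-cong (λ a → sumBy-cong (evalMono-+ x a) g) f ⟩
    sumBy (λ a → sumBy (λ b → evalMono x a ℙ.* evalMono x b) g) f ≡⟨ sumBy-cong (λ a → sumBy-*ˡ (evalMono x a) (evalMono x) g) f ⟩
    sumBy (λ a → evalMono x a ℙ.* eval x g) f                     ≡⟨ sumBy-*ʳ (eval x g) (evalMono x) f ⟩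
    eval x f ℙ.* eval x g                                         ∎
    where open ≡-Reasoning

  eval-1P : ∀ x → eval x 1P ≡ 1ℙ
  eval-1P x = trans (ℙ.+-identityʳ _) (evalMono-0 x)

  -- var is defined through a local function in Defs; this Σ-type gives access to it.
  var-exponents : ∀ (j : Fin n) → Σ (Fin n → ℕ) λ e → var j ≡ Vec.tabulate e ∷ []
  var-exponents j = _ , refl

  var-exponent-∈ : ∀ {j k} → k ∈ ⁅ j ⁆ → proj₁ (var-exponents j) k ≡ 1
  var-exponent-∈ {j} {k} k∈j with k ∈? ⁅ j ⁆
  ... | yes _   = refl
  ... | no  k∉j = ⊥-elim (k∉j k∈j)

  var-exponent-∉ : ∀ {j k} → k ∉ ⁅ j ⁆ → proj₁ (var-exponents j) k ≡ 0
  var-exponent-∉ {j} {k} k∉j with k ∈? ⁅ j ⁆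
  ... | yes k∈j = ⊥-elim (k∉j k∈j)
  ... | no  _   = refl

  eval-var : ∀ x j → eval x (var j) ≡ evalMono x (Vec.tabulate (proj₁ (var-exponents j)))
  eval-var x j = trans (cong (eval x) (proj₂ (var-exponents j))) (ℙ.+-identityʳ _)

  eval-var-∈ : ∀ {x} j → j ∈ x → eval x (var j) ≡ 1ℙ
  eval-var-∈ {x} j j∈x = trans (eval-var x j) (evalMono≡1ℙ x (Vec.tabulate e) exponent≡0∨∈)
    where
    e = proj₁ (var-exponents j)
    exponent≡0∨∈ : ∀ k → lookup (Vec.tabulate e) k ≡ 0 ⊎ k ∈ x
    exponent≡0∨∈ k with k ∈? ⁅ j ⁆
    ... | yes k∈j = inj₂ (subst (_∈ x) (sym (x∈⁅y⁆⇒x≡y j k∈j)) j∈x)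
    ... | no  k∉j = inj₁ (trans (lookup∘tabulate e k) (var-exponent-∉ k∉j))

  eval-var-∉ : ∀ {x} j → j ∉ x → eval x (var j) ≡ 0ℙ
  eval-var-∉ {x} j j∉x = trans (eval-var x j) (evalMono≡0ℙ x (Vec.tabulate e) j exponent≢0 j∉x)
    where
    e = proj₁ (var-exponents j)
    exponent≢0 : lookup (Vec.tabulate e) j ≢ 0
    exponent≢0 eq = 1+n≢0 (trans (sym (var-exponent-∈ (x∈⁅x⁆ j))) (trans (sym (lookup∘tabulate e j)) eq))

  eval-onem : ∀ x j → eval x (onem j) ≡ 1ℙ ℙ.+ eval x (var j)
  eval-onem x j = trans (eval-+P x 1P (var j)) (cong (ℙ._+ eval x (var j)) (eval-1P x))

-- Pseudo-monomials

module _ {n : ℕ} where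
  open import Algebra.Properties.CommutativeMonoid.Sum (*P-commutativeMonoid n) public
    using (∑-distrib-+; sum-cong-≋) renaming (sum to ∏)

  factor : Subset n → Subset n → Fin n → Poly n
  factor σ τ j with j ∈? σ | j ∈? τ
  ... | yes _ | _     = var j
  ... | no  _ | yes _ = onem j
  ... | no  _ | no  _ = 1P

  -- Likewise for the local function defining pm.
  pm-factors : ∀ (σ τ : Subset n) → Σ (Fin n → Poly n) λ F → pm σ τ ≡ prodP (map F (allFin n))
  pm-factors σ τ = _ , refl

  pm-factors-≗ : ∀ σ τ j → proj₁ (pm-factors σ τ) j ≡ factor σ τ j
  pm-factors-≗ σ τ j with j ∈? σ | j ∈? τ
  ... | yes _ | _     = refl
  ... | no  _ | yes _ = refl
  ... | no  _ | no  _ = refl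

  prodP-tabulate : ∀ {m} (F : Fin m → Poly n) → prodP (tabulate F) ≡ ∏ F
  prodP-tabulate {zero}  F = refl
  prodP-tabulate {suc m} F = cong (F Fin.zero *P_) (prodP-tabulate (F ∘ Fin.suc))

  pm≡∏factor : ∀ σ τ → pm σ τ ≡ ∏ (factor σ τ)
  pm≡∏factor σ τ = begin
    pm σ τ                                          ≡⟨ proj₂ (pm-factors σ τ) ⟩
    prodP (map (proj₁ (pm-factors σ τ)) (allFin n)) ≡⟨ cong prodP (map-cong (pm-factors-≗ σ τ) (allFin n)) ⟩
    prodP (map (factor σ τ) (allFin n))             ≡⟨ cong prodP (map-tabulate id (factor σ τ)) ⟩
    prodP (tabulate (factor σ τ))                   ≡⟨ prodP-tabulate (factor σ τ) ⟩
    ∏ (factor σ τ)                                  ∎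
    where open ≡-Reasoning

  factor-∈σ : ∀ {σ τ j} → j ∈ σ → factor σ τ j ≡ var j
  factor-∈σ {σ} {τ} {j} j∈σ with j ∈? σ | j ∈? τ
  ... | yes _   | _ = refl
  ... | no  j∉σ | _ = ⊥-elim (j∉σ j∈σ)

  factor-∈τ : ∀ {σ τ j} → j ∉ σ → j ∈ τ → factor σ τ j ≡ onem j
  factor-∈τ {σ} {τ} {j} j∉σ j∈τ with j ∈? σ | j ∈? τ
  ... | yes j∈σ | _       = ⊥-elim (j∉σ j∈σ)
  ... | no  _   | yes _   = refl
  ... | no  _   | no  j∉τ = ⊥-elim (j∉τ j∈τ)

  factor-∉ : ∀ {σ τ j} → j ∉ σ → j ∉ τ → factor σ τ j ≡ 1P
  factor-∉ {σ} {τ} {j} j∉σ j∉τ with j ∈? σ | j ∈? τ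
  ... | yes j∈σ | _       = ⊥-elim (j∉σ j∈σ)
  ... | no  _   | yes j∈τ = ⊥-elim (j∉τ j∈τ)
  ... | no  _   | no  _   = refl

  factor-cong : ∀ {σ σ′ τ τ′ j} → (j ∈ σ ⇔ j ∈ σ′) → (j ∈ τ ⇔ j ∈ τ′) → factor σ τ j ≡ factor σ′ τ′ j
  factor-cong {σ} {σ′} {τ} {τ′} {j} σ⇔σ′ τ⇔τ′ with j ∈? σ | j ∈? τ
  ... | yes j∈σ | _       = sym (factor-∈σ (Equivalence.to σ⇔σ′ j∈σ))
  ... | no  j∉σ | yes j∈τ = sym (factor-∈τ (j∉σ ∘ Equivalence.from σ⇔σ′) (Equivalence.to τ⇔τ′ j∈τ))
  ... | no  j∉σ | no  j∉τ = sym (factor-∉ (j∉σ ∘ Equivalence.from σ⇔σ′) (j∉τ ∘ Equivalence.from τ⇔τ′))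

  ∏-factorwise : ∀ {m} {F G H : Fin m → Poly n} → (∀ j → F j ≈ G j *P H j) → ∏ F ≈ ∏ G *P ∏ H
  ∏-factorwise {G = G} {H} F≈GH = ≈-trans (sum-cong-≋ F≈GH) (∑-distrib-+ G H)

  ∏-single : ∀ {m} (i : Fin m) (f : Poly n) → ∏ (λ j → if does (j ≟ i) then f else 1P) ≈ f
  ∏-single = sum-single (*P-commutativeMonoid n)

  pm-refine : ∀ {σ τ σ′ τ′} k → (∀ j → j ≢ k → factor σ′ τ′ j ≡ factor σ τ j) → factor σ τ k ≡ 1P →
              pm σ′ τ′ ≈ pm σ τ *P factor σ′ τ′ k
  pm-refine {σ} {τ} {σ′} {τ′} k agree k-free = begin
    pm σ′ τ′                                                                ≡⟨ pm≡∏factor σ′ τ′ ⟩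
    ∏ (factor σ′ τ′)                                                        ≈⟨ ∏-factorwise pointwise ⟩
    ∏ (factor σ τ) *P ∏ (λ j → if does (j ≟ k) then factor σ′ τ′ k else 1P) ≡⟨ cong (_*P _) (pm≡∏factor σ τ) ⟨
    pm σ τ *P ∏ (λ j → if does (j ≟ k) then factor σ′ τ′ k else 1P)         ≈⟨ *P-congˡ (pm σ τ) (∏-single k _) ⟩
    pm σ τ *P factor σ′ τ′ k                                                ∎
    where
    open ≈-Reasoning
    pointwise : ∀ j → factor σ′ τ′ j ≈ factor σ τ j *P (if does (j ≟ k) then factor σ′ τ′ k else 1P)
    pointwise j with j ≟ k
    ... | yes refl = begin
      factor σ′ τ′ j                 ≈⟨ *P-identityˡ (factor σ′ τ′ j) ⟨
      1P *P factor σ′ τ′ j           ≡⟨ cong (_*P factor σ′ τ′ j) (sym k-free) ⟩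
      factor σ τ j *P factor σ′ τ′ j ∎
    ... | no j≢k = begin
      factor σ′ τ′ j     ≡⟨ agree j j≢k ⟩
      factor σ τ j       ≈⟨ *P-identityʳ (factor σ τ j) ⟨
      factor σ τ j *P 1P ∎

  pm-∪⁅⁆ˡ : ∀ {α β k} → k ∉ α → k ∉ β → pm (α ∪ ⁅ k ⁆) β ≈ pm α β *P var k
  pm-∪⁅⁆ˡ {α} {β} {k} k∉α k∉β = ≈-trans
    (pm-refine k (λ j j≢k → factor-cong (∈-∪⁅⁆⇔ j≢k) ⇔-refl) (factor-∉ k∉α k∉β))
    (≡⇒≈ (cong (pm α β *P_) (factor-∈σ (x∈p∪⁅x⁆ α k))))

  pm-∪⁅⁆ʳ : ∀ {α β k} → k ∉ α → k ∉ β → pm α (β ∪ ⁅ k ⁆) ≈ pm α β *P onem k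
  pm-∪⁅⁆ʳ {α} {β} {k} k∉α k∉β = ≈-trans
    (pm-refine k (λ j j≢k → factor-cong ⇔-refl (∈-∪⁅⁆⇔ j≢k)) (factor-∉ k∉α k∉β))
    (≡⇒≈ (cong (pm α β *P_) (factor-∈τ k∉α (x∈p∪⁅x⁆ β k))))

  pm-split : ∀ {α β k} → k ∉ α → k ∉ β → pm α β ≈ pm (α ∪ ⁅ k ⁆) β +P pm α (β ∪ ⁅ k ⁆)
  pm-split {α} {β} {k} k∉α k∉β = begin
    pm α β                                  ≈⟨ *P-identityʳ (pm α β) ⟨
    pm α β *P 1P                            ≈⟨ *P-congˡ (pm α β) (+P-cancelˡ (var k) 1P) ⟨
    pm α β *P (var k +P onem k)             ≈⟨ *P-distribˡ-+P (pm α β) (var k) (onem k) ⟩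
    (pm α β *P var k) +P (pm α β *P onem k) ≈⟨ +P-cong (pm-∪⁅⁆ˡ k∉α k∉β) (pm-∪⁅⁆ʳ k∉α k∉β) ⟨
    pm (α ∪ ⁅ k ⁆) β +P pm α (β ∪ ⁅ k ⁆)    ∎
    where open ≈-Reasoning

  pm-factorise : ∀ {σ τ σ′ τ′ : Subset n} → Disjoint σ τ → σ′ ⊆ σ → τ′ ⊆ τ →
                 pm σ τ ≈ pm (σ ─ σ′) (τ ─ τ′) *P pm σ′ τ′
  pm-factorise {σ} {τ} {σ′} {τ′} σ∩τ=∅ σ′⊆σ τ′⊆τ = begin
    pm σ τ                                           ≡⟨ pm≡∏factor σ τ ⟩
    ∏ (factor σ τ)                                   ≈⟨ ∏-factorwise pointwise ⟩
    ∏ (factor (σ ─ σ′) (τ ─ τ′)) *P ∏ (factor σ′ τ′) ≡⟨ cong₂ _*P_ (pm≡∏factor (σ ─ σ′) (τ ─ τ′)) (pm≡∏factor σ′ τ′) ⟨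
    pm (σ ─ σ′) (τ ─ τ′) *P pm σ′ τ′                 ∎
    where
    open ≈-Reasoning
    pointwise : ∀ j → factor σ τ j ≈ factor (σ ─ σ′) (τ ─ τ′) j *P factor σ′ τ′ j
    pointwise j = by-cases (j ∈? σ′) (j ∈? τ′)
      where
      by-cases : Dec (j ∈ σ′) → Dec (j ∈ τ′) → factor σ τ j ≈ factor (σ ─ σ′) (τ ─ τ′) j *P factor σ′ τ′ j
      by-cases (yes j∈σ′) _ = begin
        factor σ τ j                                 ≡⟨ factor-∈σ (σ′⊆σ j∈σ′) ⟩
        var j                                        ≈⟨ *P-identityˡ (var j) ⟨
        1P *P var j                                  ≡⟨ cong₂ _*P_ cofactor≡1P (factor-∈σ j∈σ′) ⟨
        factor (σ ─ σ′) (τ ─ τ′) j *P factor σ′ τ′ j ∎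
        where
        cofactor≡1P : factor (σ ─ σ′) (τ ─ τ′) j ≡ 1P
        cofactor≡1P = factor-∉ (λ j∈ → x∈p─q⇒x∉q j∈ j∈σ′) (σ∩τ=∅ (σ′⊆σ j∈σ′) ∘ p─q⊆p τ τ′)
      by-cases (no j∉σ′) (yes j∈τ′) = begin
        factor σ τ j                                 ≡⟨ factor-∈τ j∉σ (τ′⊆τ j∈τ′) ⟩
        onem j                                       ≈⟨ *P-identityˡ (onem j) ⟨
        1P *P onem j                                 ≡⟨ cong₂ _*P_ cofactor≡1P (factor-∈τ j∉σ′ j∈τ′) ⟨
        factor (σ ─ σ′) (τ ─ τ′) j *P factor σ′ τ′ j ∎
        where
        j∉σ : j ∉ σ
        j∉σ j∈σ = σ∩τ=∅ j∈σ (τ′⊆τ j∈τ′)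
        cofactor≡1P : factor (σ ─ σ′) (τ ─ τ′) j ≡ 1P
        cofactor≡1P = factor-∉ (j∉σ ∘ p─q⊆p σ σ′) (λ j∈ → x∈p─q⇒x∉q j∈ j∈τ′)
      by-cases (no j∉σ′) (no j∉τ′) = begin
        factor σ τ j                                 ≡⟨ factor-cong (∈-─⇔ j∉σ′) (∈-─⇔ j∉τ′) ⟨
        factor (σ ─ σ′) (τ ─ τ′) j                   ≈⟨ *P-identityʳ (factor (σ ─ σ′) (τ ─ τ′) j) ⟨
        factor (σ ─ σ′) (τ ─ τ′) j *P 1P             ≡⟨ cong (factor (σ ─ σ′) (τ ─ τ′) j *P_) (factor-∉ j∉σ′ j∉τ′) ⟨
        factor (σ ─ σ′) (τ ─ τ′) j *P factor σ′ τ′ j ∎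

  pm-∣ : ∀ {σ τ σ′ τ′ : Subset n} → Disjoint σ τ → σ′ ⊆ σ → τ′ ⊆ τ → pm σ′ τ′ ∣P pm σ τ
  pm-∣ {σ} {τ} {σ′} {τ′} σ∩τ=∅ σ′⊆σ τ′⊆τ = pm (σ ─ σ′) (τ ─ τ′) , ≈⇒≈P (pm-factorise σ∩τ=∅ σ′⊆σ τ′⊆τ)

module _ {n : ℕ} (x : Subset n) where

  eval-∏≡1ℙ⁺ : ∀ {m} (F : Fin m → Poly n) → (∀ j → eval x (F j) ≡ 1ℙ) → eval x (∏ F) ≡ 1ℙ
  eval-∏≡1ℙ⁺ {zero}  F _  = eval-1P x
  eval-∏≡1ℙ⁺ {suc m} F ≡1 =
    trans (eval-*P x (F Fin.zero) (∏ (F ∘ Fin.suc))) (cong₂ ℙ._*_ (≡1 Fin.zero) (eval-∏≡1ℙ⁺ (F ∘ Fin.suc) (≡1 ∘ Fin.suc)))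

  eval-*P≡1ℙ⁻ : ∀ f g → eval x (f *P g) ≡ 1ℙ → eval x f ≡ 1ℙ × eval x g ≡ 1ℙ
  eval-*P≡1ℙ⁻ f g ≡1 = *≡1ℙ⁻ (eval x f) (eval x g) (trans (sym (eval-*P x f g)) ≡1)

  eval-∏≡1ℙ⁻ : ∀ {m} (F : Fin m → Poly n) → eval x (∏ F) ≡ 1ℙ → ∀ j → eval x (F j) ≡ 1ℙ
  eval-∏≡1ℙ⁻ F ≡1 Fin.zero    = proj₁ (eval-*P≡1ℙ⁻ (F Fin.zero) (∏ (F ∘ Fin.suc)) ≡1)
  eval-∏≡1ℙ⁻ F ≡1 (Fin.suc j) = eval-∏≡1ℙ⁻ (F ∘ Fin.suc) (proj₂ (eval-*P≡1ℙ⁻ (F Fin.zero) (∏ (F ∘ Fin.suc)) ≡1)) j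

  eval-onem-∉ : ∀ j → j ∉ x → eval x (onem j) ≡ 1ℙ
  eval-onem-∉ j j∉x = trans (eval-onem x j) (cong (1ℙ ℙ.+_) (eval-var-∉ j j∉x))

  eval-onem-∈ : ∀ j → j ∈ x → eval x (onem j) ≡ 0ℙ
  eval-onem-∈ j j∈x = trans (eval-onem x j) (cong (1ℙ ℙ.+_) (eval-var-∈ j j∈x))

  eval-pm≡1ℙ⁺ : ∀ {σ τ} → σ ⊆ x → Disjoint x τ → eval x (pm σ τ) ≡ 1ℙ
  eval-pm≡1ℙ⁺ {σ} {τ} σ⊆x x∩τ=∅ =
    trans (cong (eval x) (pm≡∏factor σ τ)) (eval-∏≡1ℙ⁺ (factor σ τ) λ j → by-cases j (j ∈? σ) (j ∈? τ))
    where
    by-cases : ∀ j → Dec (j ∈ σ) → Dec (j ∈ τ) → eval x (factor σ τ j) ≡ 1ℙ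
    by-cases j (yes j∈σ) _         = trans (cong (eval x) (factor-∈σ j∈σ)) (eval-var-∈ j (σ⊆x j∈σ))
    by-cases j (no  j∉σ) (yes j∈τ) = trans (cong (eval x) (factor-∈τ j∉σ j∈τ)) (eval-onem-∉ j (λ j∈x → x∩τ=∅ j∈x j∈τ))
    by-cases j (no  j∉σ) (no  j∉τ) = trans (cong (eval x) (factor-∉ j∉σ j∉τ)) (eval-1P x)

  eval-pm≡1ℙ⁻ : ∀ {σ τ} → Disjoint σ τ → eval x (pm σ τ) ≡ 1ℙ → σ ⊆ x × Disjoint x τ
  eval-pm≡1ℙ⁻ {σ} {τ} σ∩τ=∅ ≡1 = σ⊆x , x∩τ=∅
    where
    open ≡-Reasoning
    factor≡1 : ∀ j → eval x (factor σ τ j) ≡ 1ℙ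
    factor≡1 = eval-∏≡1ℙ⁻ (factor σ τ) (trans (cong (eval x) (sym (pm≡∏factor σ τ))) ≡1)
    σ⊆x : σ ⊆ x
    σ⊆x {j} j∈σ with j ∈? x
    ... | yes j∈x = j∈x
    ... | no  j∉x = ⊥-elim (0ℙ≢1ℙ (begin
      0ℙ                    ≡⟨ eval-var-∉ j j∉x ⟨
      eval x (var j)        ≡⟨ cong (eval x) (factor-∈σ j∈σ) ⟨
      eval x (factor σ τ j) ≡⟨ factor≡1 j ⟩
      1ℙ                    ∎))
    x∩τ=∅ : Disjoint x τ
    x∩τ=∅ {j} j∈x j∈τ = 0ℙ≢1ℙ (begin
      0ℙ                    ≡⟨ eval-onem-∈ j j∈x ⟨
      eval x (onem j)       ≡⟨ cong (eval x) (factor-∈τ (λ j∈σ → σ∩τ=∅ j∈σ j∈τ) j∈τ) ⟨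
      eval x (factor σ τ j) ≡⟨ factor≡1 j ⟩
      1ℙ                    ∎)

module _ {n : ℕ} where

  eval-∣ : ∀ x {f g : Poly n} → g ∣P f → eval x f ≡ 1ℙ → eval x g ≡ 1ℙ
  eval-∣ x {f} {g} (h , f≈P) f≡1 =
    proj₂ (eval-*P≡1ℙ⁻ x h g (trans (sym (eval-≈ x (≈P⇒≈ {f = f} {h *P g} f≈P))) f≡1))

  pm-∣⇒⊆ : ∀ {σ τ σ′ τ′ : Subset n} → Disjoint σ τ → Disjoint σ′ τ′ → pm σ τ ∣P pm σ′ τ′ → σ ⊆ σ′ × τ ⊆ τ′
  pm-∣⇒⊆ {σ} {τ} {σ′} {τ′} σ∩τ=∅ σ′∩τ′=∅ pm∣pm′ = σ⊆σ′ , τ⊆τ′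
    where
    pm≡1-at : ∀ x → σ′ ⊆ x → Disjoint x τ′ → σ ⊆ x × Disjoint x τ
    pm≡1-at x σ′⊆x x∩τ′=∅ = eval-pm≡1ℙ⁻ x σ∩τ=∅ (eval-∣ x {pm σ′ τ′} {pm σ τ} pm∣pm′ (eval-pm≡1ℙ⁺ x σ′⊆x x∩τ′=∅))
    σ⊆σ′ : σ ⊆ σ′
    σ⊆σ′ = proj₁ (pm≡1-at σ′ ⊆-refl σ′∩τ′=∅)
    τ⊆τ′ : τ ⊆ τ′
    τ⊆τ′ j∈τ = x∉∁p⇒x∈p (λ j∈∁τ′ → proj₂ (pm≡1-at (∁ τ′) (x∉p⇒x∈∁p ∘ σ′∩τ′=∅) x∈∁p⇒x∉p) j∈∁τ′ j∈τ)

-- The neural ideal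

module _ {n : ℕ} where

  -- Some codeword lies in the interval [σ, [n] ∖ τ], so that pm σ τ does not vanish on C.
  Meets : Code n → Subset n → Subset n → Set
  Meets C σ τ = Σ (Subset n) λ c → C c × σ ⊆ c × Disjoint c τ

  Meets-antitone : ∀ {C : Code n} {σ τ σ′ τ′} → σ ⊆ σ′ → τ ⊆ τ′ → Meets C σ′ τ′ → Meets C σ τ
  Meets-antitone σ⊆σ′ τ⊆τ′ (c , Cc , σ′⊆c , c∩τ′=∅) =
    c , Cc , (λ j∈σ → σ′⊆c (σ⊆σ′ j∈σ)) , λ j∈c j∈τ → c∩τ′=∅ j∈c (τ⊆τ′ j∈τ)

  combination : List (Poly n × Subset n) → Poly n
  combination = foldr (λ p acc → (proj₁ p *P ρ (proj₂ p)) +P acc) 0P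

  eval-ρ≡1ℙ⁻ : ∀ {x v : Subset n} → eval x (ρ v) ≡ 1ℙ → x ≡ v
  eval-ρ≡1ℙ⁻ {x} {v} ≡1 with eval-pm≡1ℙ⁻ x x∈p⇒x∉∁p ≡1
  ... | v⊆x , x∩∁v=∅ = ⊆-antisym (λ j∈x → x∉∁p⇒x∈p (x∩∁v=∅ j∈x)) v⊆x

  eval-combination : ∀ {C : Code n} {c} hs → C c → All (λ p → ¬ C (proj₂ p)) hs → eval c (combination hs) ≡ 0ℙ
  eval-combination []             _  []           = refl
  eval-combination {C} {c} ((h , v) ∷ hs) Cc (¬Cv ∷ ¬Chs) = begin
    eval c ((h *P ρ v) +P combination hs)         ≡⟨ eval-+P c (h *P ρ v) (combination hs) ⟩
    eval c (h *P ρ v) ℙ.+ eval c (combination hs) ≡⟨ cong₂ ℙ._+_ (eval-*P c h (ρ v)) (eval-combination hs Cc ¬Chs) ⟩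
    eval c h ℙ.* eval c (ρ v) ℙ.+ 0ℙ              ≡⟨ cong (λ p → eval c h ℙ.* p ℙ.+ 0ℙ) ρ-vanishes ⟩
    eval c h ℙ.* 0ℙ ℙ.+ 0ℙ                        ≡⟨ cong (ℙ._+ 0ℙ) (ℙ.*-zeroʳ (eval c h)) ⟩
    0ℙ                                            ∎
    where
    open ≡-Reasoning
    ρ-vanishes : eval c (ρ v) ≡ 0ℙ
    ρ-vanishes with eval c (ρ v) in eq
    ... | 0ℙ = refl
    ... | 1ℙ = ⊥-elim (¬Cv (subst C (eval-ρ≡1ℙ⁻ eq) Cc))

  InJ-vanishes : ∀ {C : Code n} {c f} → InJ C f → C c → eval c f ≡ 0ℙ
  InJ-vanishes {C} {c} {f} (hs , ¬Chs , f≈P) Cc =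
    trans (eval-≈ c (≈P⇒≈ {f = f} {combination hs} f≈P)) (eval-combination hs Cc ¬Chs)

  InJ⇒¬Meets : ∀ {C : Code n} {σ τ} → InJ C (pm σ τ) → ¬ Meets C σ τ
  InJ⇒¬Meets {C} {σ} {τ} pm∈J (c , Cc , σ⊆c , c∩τ=∅) =
    0ℙ≢1ℙ (trans (sym (InJ-vanishes {C} {c} {pm σ τ} pm∈J Cc)) (eval-pm≡1ℙ⁺ c σ⊆c c∩τ=∅))

  module _ {C : Code n} where

    InJ-≈ : ∀ {f g} → f ≈ g → InJ C g → InJ C f
    InJ-≈ {f} {g} f≈g (hs , ¬Chs , g≈P) =
      hs , ¬Chs , ≈⇒≈P (≈-trans f≈g (≈P⇒≈ {f = g} {combination hs} g≈P))

    combination-++ : ∀ hs hs′ → combination (hs ++ hs′) ≡ combination hs +P combination hs′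
    combination-++ []              hs′ = refl
    combination-++ ((h , v) ∷ hs) hs′ =
      trans (cong ((h *P ρ v) +P_) (combination-++ hs hs′)) (sym (++-assoc (h *P ρ v) (combination hs) (combination hs′)))

    InJ-+P : ∀ {f g} → InJ C f → InJ C g → InJ C (f +P g)
    InJ-+P {f} {g} (hs , ¬Chs , f≈P) (hs′ , ¬Chs′ , g≈P) = hs ++ hs′ , ++⁺ ¬Chs ¬Chs′ , ≈⇒≈P (begin
      f +P g                            ≈⟨ +P-cong (≈P⇒≈ {f = f} {combination hs} f≈P) (≈P⇒≈ {f = g} {combination hs′} g≈P) ⟩
      combination hs +P combination hs′ ≡⟨ combination-++ hs hs′ ⟨
      combination (hs ++ hs′)           ∎)
      where open ≈-Reasoning

    ρ-InJ : ∀ {v} → ¬ C v → InJ C (ρ v)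
    ρ-InJ {v} ¬Cv = (1P , v) ∷ [] , ¬Cv ∷ [] , ≈⇒≈P (begin
      ρ v               ≈⟨ *P-identityˡ (ρ v) ⟨
      1P *P ρ v         ≡⟨ ++-identityʳ (1P *P ρ v) ⟨
      (1P *P ρ v) +P 0P ∎)
      where open ≈-Reasoning

    FreeAmong : List (Fin n) → Subset n → Subset n → Set
    FreeAmong L α β = ∀ k → k ∉ α → k ∉ β → k ∈ᴸ L

    FreeAmong-∷ : ∀ {j L α β α′ β′} → FreeAmong (j ∷ L) α β → α ⊆ α′ → β ⊆ β′ → j ∈ α′ ⊎ j ∈ β′ → FreeAmong L α′ β′
    FreeAmong-∷ free α⊆α′ β⊆β′ j∈ k k∉α′ k∉β′ with free k (λ k∈α → k∉α′ (α⊆α′ k∈α)) (λ k∈β → k∉β′ (β⊆β′ k∈β))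
    FreeAmong-∷ free α⊆α′ β⊆β′ (inj₁ j∈α′) k k∉α′ k∉β′ | here refl = ⊥-elim (k∉α′ j∈α′)
    FreeAmong-∷ free α⊆α′ β⊆β′ (inj₂ j∈β′) k k∉α′ k∉β′ | here refl = ⊥-elim (k∉β′ j∈β′)
    FreeAmong-∷ free α⊆α′ β⊆β′ j∈             k k∉α′ k∉β′ | there k∈L = k∈L

    -- Split pm α β along the free coordinates (pm-split) until it is a generator ρ α.
    ¬Meets⇒InJ-splitting : ∀ L {α β} → Disjoint α β → FreeAmong L α β → ¬ Meets C α β → InJ C (pm α β)
    ¬Meets⇒InJ-splitting [] {α} {β} α∩β=∅ free ¬meets =
      subst (λ β → InJ C (pm α β)) (sym β≡∁α) (ρ-InJ (λ Cα → ¬meets (α , Cα , ⊆-refl , α∩β=∅)))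
      where
      ∁α⊆β : ∁ α ⊆ β
      ∁α⊆β {k} k∈∁α with k ∈? β
      ... | yes k∈β = k∈β
      ... | no  k∉β with free k (x∈∁p⇒x∉p k∈∁α) k∉β
      ...   | ()
      β≡∁α : β ≡ ∁ α
      β≡∁α = ⊆-antisym (λ k∈β → x∉p⇒x∈∁p (λ k∈α → α∩β=∅ k∈α k∈β)) ∁α⊆β
    ¬Meets⇒InJ-splitting (j ∷ L) {α} {β} α∩β=∅ free ¬meets with j ∈? α | j ∈? β
    ... | yes j∈α | _       = ¬Meets⇒InJ-splitting L α∩β=∅ (FreeAmong-∷ free ⊆-refl ⊆-refl (inj₁ j∈α)) ¬meets
    ... | no  _   | yes j∈β = ¬Meets⇒InJ-splitting L α∩β=∅ (FreeAmong-∷ free ⊆-refl ⊆-refl (inj₂ j∈β)) ¬meets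
    ... | no  j∉α | no  j∉β = InJ-≈ (pm-split j∉α j∉β) (InJ-+P {pm (α ∪ ⁅ j ⁆) β} {pm α (β ∪ ⁅ j ⁆)}
      (¬Meets⇒InJ-splitting L disjointˡ (FreeAmong-∷ free (p⊆p∪q ⁅ j ⁆) ⊆-refl (inj₁ (x∈p∪⁅x⁆ α j)))
        (¬meets ∘ Meets-antitone (p⊆p∪q ⁅ j ⁆) ⊆-refl))
      (¬Meets⇒InJ-splitting L disjointʳ (FreeAmong-∷ free ⊆-refl (p⊆p∪q ⁅ j ⁆) (inj₂ (x∈p∪⁅x⁆ β j)))
        (¬meets ∘ Meets-antitone ⊆-refl (p⊆p∪q ⁅ j ⁆))))
      where
      disjointˡ : Disjoint (α ∪ ⁅ j ⁆) β
      disjointˡ k∈ k∈β with x∈p∪q⁻ α ⁅ j ⁆ k∈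
      ... | inj₁ k∈α = α∩β=∅ k∈α k∈β
      ... | inj₂ k∈j = j∉β (subst (_∈ β) (x∈⁅y⁆⇒x≡y j k∈j) k∈β)
      disjointʳ : Disjoint α (β ∪ ⁅ j ⁆)
      disjointʳ k∈α k∈ with x∈p∪q⁻ β ⁅ j ⁆ k∈
      ... | inj₁ k∈β = α∩β=∅ k∈α k∈β
      ... | inj₂ k∈j = j∉α (subst (_∈ α) (x∈⁅y⁆⇒x≡y j k∈j) k∈α)

    ¬Meets⇒InJ : ∀ {α β} → Disjoint α β → ¬ Meets C α β → InJ C (pm α β)
    ¬Meets⇒InJ α∩β=∅ = ¬Meets⇒InJ-splitting (allFin n) α∩β=∅ (λ k _ _ → ∈-allFin k)

-- Inductively pierced codes

module _ {n : ℕ} where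

  -- A divisor x_i, x_i x_j or x_i (1 - x_j) of pm σ τ lying in J_C.
  data Obstruction (C : Code n) (σ τ : Subset n) : Set where
    silent    : ∀ {i} → i ∈ σ → ¬ Meets C ⁅ i ⁆ ∅ → Obstruction C σ τ
    quadratic : ∀ {σ′ τ′} → σ′ ⊆ σ → τ′ ⊆ τ → pmDegree σ′ τ′ ≡ 2 → ¬ Meets C σ′ τ′ → Obstruction C σ τ

  Meets⇒Meets-del : ∀ {C : Code n} {i σ τ} → i ∉ σ → Meets C σ τ → Meets (del C i) σ τ
  Meets⇒Meets-del {i = i} {σ} i∉σ (c , Cc , σ⊆c , c∩τ=∅) =
    c ─ ⁅ i ⁆ , (c , Cc , refl) ,
    (λ {j} j∈σ → x∈p∧x∉q⇒x∈p─q (σ⊆c j∈σ) (λ j∈i → i∉σ (subst (_∈ σ) (x∈⁅y⁆⇒x≡y i j∈i) j∈σ))) ,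
    (λ j∈c─i → c∩τ=∅ (p─q⊆p c ⁅ i ⁆ j∈c─i))

  Obstruction-del : ∀ {C : Code n} {i σ τ τ′} → i ∉ σ → τ′ ⊆ τ → Obstruction (del C i) σ τ′ → Obstruction C σ τ
  Obstruction-del i∉σ τ′⊆τ (silent {j} j∈σ ¬meets) =
    silent j∈σ (¬meets ∘ Meets⇒Meets-del (λ i∈j → i∉σ (subst (_∈ _) (sym (x∈⁅y⁆⇒x≡y j i∈j)) j∈σ)))
  Obstruction-del i∉σ τ′⊆τ (quadratic σ″⊆σ τ″⊆τ′ deg ¬meets) =
    quadratic σ″⊆σ (λ j∈τ″ → τ′⊆τ (τ″⊆τ′ j∈τ″)) deg (¬meets ∘ Meets⇒Meets-del (λ i∈σ″ → i∉σ (σ″⊆σ i∈σ″)))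

  module Pierced {C : Code n} {i : Fin n} {σ₀ τ₀ : Subset n} (σ₀⊆τ₀ : σ₀ ⊆ τ₀)
                 (C≐ : ∀ c → C c ⇔ (del C i c ⊎ InInterval (σ₀ ∪ ⁅ i ⁆) (τ₀ ∪ ⁅ i ⁆) c)) where

    Meets-del⇒Meets : ∀ {σ τ} → Meets (del C i) σ (τ ─ ⁅ i ⁆) → Meets C σ τ
    Meets-del⇒Meets (_ , c∖i∈C∖i@(c , _ , refl) , σ⊆c∖i , c∖i∩τ∖i=∅) =
      c ─ ⁅ i ⁆ , Equivalence.from (C≐ (c ─ ⁅ i ⁆)) (inj₁ c∖i∈C∖i) , σ⊆c∖i ,
      λ j∈c∖i j∈τ → c∖i∩τ∖i=∅ j∈c∖i (x∈p∧x∉q⇒x∈p─q j∈τ (x∈p─q⇒x∉q j∈c∖i))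

    ∋i⇒InInterval : ∀ {c} → C c → i ∈ c → InInterval (σ₀ ∪ ⁅ i ⁆) (τ₀ ∪ ⁅ i ⁆) c
    ∋i⇒InInterval {c} Cc i∈c with Equivalence.to (C≐ c) Cc
    ... | inj₂ c∈interval   = c∈interval
    ... | inj₁ (_ , _ , refl) = ⊥-elim (x∈p─q⇒x∉q i∈c (x∈⁅x⁆ i))

    -- Codewords containing i lie in [σ₀ ∪ i, τ₀ ∪ i]. Unless some j ∈ σ lies outside τ₀ ∪ i
    -- (giving x_i x_j) or some j ∈ τ lies in σ₀ (giving x_i (1 - x_j)), σ₀ ∪ σ is such a
    -- codeword and meets (σ, τ).
    obstruction-∋i : ∀ {σ τ} → i ∈ σ → Disjoint σ τ → ¬ Meets C σ τ → Obstruction C σ τ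
    obstruction-∋i {σ} {τ} i∈σ σ∩τ=∅ ¬meets with any? (λ j → j ∈? σ ×-dec ¬? (j ∈? τ₀) ×-dec ¬? (j ≟ i))
    ... | yes (j , j∈σ , j∉τ₀ , j≢i) =
      quadratic (∪-⊆ (⁅x⁆⊆p i∈σ) (⁅x⁆⊆p j∈σ)) ⊥⊆
        (trans (cong (∣ ⁅ i ⁆ ∪ ⁅ j ⁆ ∣ +_) (∣⊥∣≡0 n)) (trans (+-identityʳ _) (∣⁅x⁆∪⁅y⁆∣≡2 (j≢i ∘ sym))))
        λ (c , Cc , ij⊆c , _) →
          j∉τ₀∪i (proj₂ (∋i⇒InInterval Cc (ij⊆c (x∈p∪q⁺ (inj₁ (x∈⁅x⁆ i))))) (ij⊆c (x∈p∪⁅x⁆ ⁅ i ⁆ j)))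
      where
      j∉τ₀∪i : j ∉ τ₀ ∪ ⁅ i ⁆
      j∉τ₀∪i j∈ with x∈p∪q⁻ τ₀ ⁅ i ⁆ j∈
      ... | inj₁ j∈τ₀ = j∉τ₀ j∈τ₀
      ... | inj₂ j∈i  = j≢i (x∈⁅y⁆⇒x≡y i j∈i)
    ... | no no-loose-j with any? (λ j → j ∈? τ ×-dec j ∈? σ₀)
    ...   | yes (j , j∈τ , j∈σ₀) =
      quadratic (⁅x⁆⊆p i∈σ) (⁅x⁆⊆p j∈τ) (cong₂ _+_ (∣⁅x⁆∣≡1 i) (∣⁅x⁆∣≡1 j))
        λ (c , Cc , i⊆c , c∩j=∅) → c∩j=∅ (proj₁ (∋i⇒InInterval Cc (i⊆c (x∈⁅x⁆ i))) (x∈p∪q⁺ (inj₁ j∈σ₀))) (x∈⁅x⁆ j)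
    ...   | no no-clash = ⊥-elim (¬meets (σ₀ ∪ σ , σ₀∪σ∈C , q⊆p∪q σ₀ σ , disjoint))
      where
      lower : σ₀ ∪ ⁅ i ⁆ ⊆ σ₀ ∪ σ
      lower = ∪-⊆ (p⊆p∪q σ) (q⊆p∪q σ₀ σ ∘ ⁅x⁆⊆p i∈σ)
      upper : σ₀ ∪ σ ⊆ τ₀ ∪ ⁅ i ⁆
      upper = ∪-⊆ (p⊆p∪q ⁅ i ⁆ ∘ σ₀⊆τ₀) σ⊆τ₀∪i
        where
        σ⊆τ₀∪i : σ ⊆ τ₀ ∪ ⁅ i ⁆
        σ⊆τ₀∪i {j} j∈σ with j ∈? τ₀ | j ≟ i
        ... | yes j∈τ₀ | _        = p⊆p∪q ⁅ i ⁆ j∈τ₀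
        ... | no  _    | yes refl = x∈p∪⁅x⁆ τ₀ i
        ... | no  j∉τ₀ | no  j≢i  = ⊥-elim (no-loose-j (j , j∈σ , j∉τ₀ , j≢i))
      σ₀∪σ∈C : C (σ₀ ∪ σ)
      σ₀∪σ∈C = Equivalence.from (C≐ (σ₀ ∪ σ)) (inj₂ (lower , upper))
      disjoint : Disjoint (σ₀ ∪ σ) τ
      disjoint {j} j∈ j∈τ with x∈p∪q⁻ σ₀ σ j∈
      ... | inj₁ j∈σ₀ = no-clash (j , j∈τ , j∈σ₀)
      ... | inj₂ j∈σ  = σ∩τ=∅ j∈σ j∈τ

  obstruction : ∀ {k} {C : Code n} → KInductivelyPierced k C →
                ∀ {σ τ} → Disjoint σ τ → ¬ Meets C σ τ → Obstruction C σ τ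
  obstruction (base C≐⁅∅⁆) {σ} σ∩τ=∅ ¬meets with nonempty? σ
  ... | yes (i , i∈σ) =
    silent i∈σ λ (c , Cc , i⊆c , _) → ∉⊥ (subst (i ∈_) (Equivalence.to (C≐⁅∅⁆ c) Cc) (i⊆c (x∈⁅x⁆ i)))
  ... | no σ-empty =
    ⊥-elim (¬meets (∅ , Equivalence.from (C≐⁅∅⁆ ∅) refl , (λ {j} j∈σ → ⊥-elim (σ-empty (j , j∈σ))) , λ j∈∅ _ → ∉⊥ j∈∅))
  obstruction (step i _ _ (σ₀ , τ₀ , σ₀⊆τ₀ , _ , _ , _ , C≐) pierced) {σ} {τ} σ∩τ=∅ ¬meets with i ∈? σ
  ... | yes i∈σ = obstruction-∋i i∈σ σ∩τ=∅ ¬meets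
    where open Pierced σ₀⊆τ₀ C≐
  ... | no  i∉σ = Obstruction-del i∉σ (p─q⊆p τ ⁅ i ⁆)
    (obstruction pierced (λ j∈σ → σ∩τ=∅ j∈σ ∘ p─q⊆p τ ⁅ i ⁆) (¬meets ∘ Meets-del⇒Meets))
    where open Pierced σ₀⊆τ₀ C≐

  InCF-minimal : ∀ {C : Code n} {σ τ σ′ τ′} → InCF C σ τ → σ′ ⊆ σ → τ′ ⊆ τ → ¬ Meets C σ′ τ′ → σ′ ≡ σ × τ′ ≡ τ
  InCF-minimal {C} {σ} {τ} {σ′} {τ′} (σ∩τ=∅ , _ , minimal) σ′⊆σ τ′⊆τ ¬meets =
    ⊆-antisym σ′⊆σ (proj₁ inclusions) , ⊆-antisym τ′⊆τ (proj₂ inclusions)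
    where
    σ′∩τ′=∅ : Disjoint σ′ τ′
    σ′∩τ′=∅ j∈σ′ j∈τ′ = σ∩τ=∅ (σ′⊆σ j∈σ′) (τ′⊆τ j∈τ′)
    pm∣pm′ : pm σ τ ∣P pm σ′ τ′
    pm∣pm′ = minimal σ′ τ′ σ′∩τ′=∅ (¬Meets⇒InJ {C = C} σ′∩τ′=∅ ¬meets) (pm-∣ σ∩τ=∅ σ′⊆σ τ′⊆τ)
    inclusions : σ ⊆ σ′ × τ ⊆ τ′
    inclusions = pm-∣⇒⊆ σ∩τ=∅ σ′∩τ′=∅ pm∣pm′

  covered⇒Meets : ∀ {C : Code n} → Conventions C → ∀ i → Meets C ⁅ i ⁆ ∅
  covered⇒Meets conventions i with Conventions.covered conventions i
  ... | c , Cc , i∈c = c , Cc , ⁅x⁆⊆p i∈c , λ _ → ∉⊥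

  InCF-degree : ∀ {C : Code n} {σ τ} → Conventions C → InCF C σ τ → Obstruction C σ τ → pmDegree σ τ ≡ 2
  InCF-degree conventions _ (silent {i} _ ¬meets) = ⊥-elim (¬meets (covered⇒Meets conventions i))
  InCF-degree {C} {σ} {τ} _ cf (quadratic {σ′} {τ′} σ′⊆σ τ′⊆τ degree≡2 ¬meets) =
    subst₂ (λ σ τ → pmDegree σ τ ≡ 2) (proj₁ σ′≡σ×τ′≡τ) (proj₂ σ′≡σ×τ′≡τ) degree≡2
    where
    σ′≡σ×τ′≡τ : σ′ ≡ σ × τ′ ≡ τ
    σ′≡σ×τ′≡τ = InCF-minimal {C = C} {σ} {τ} cf σ′⊆σ τ′⊆τ ¬meets

proposition1 : ∀ (n : ℕ) (C : Code n) → Conventions C → InductivelyPierced C →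
                 ∀ (σ τ : Subset n) → InCF C σ τ → pmDegree σ τ ≡ 2
proposition1 n C conventions (_ , pierced) σ τ cf@(σ∩τ=∅ , pm∈J , _) =
  InCF-degree conventions cf (obstruction pierced σ∩τ=∅ (InJ⇒¬Meets {C = C} {σ} {τ} pm∈J))
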